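{- Let $T$ be a string of length $n$ and $1 \le i \le j < n$. For any $[s,t]$ with $i \le s < t \le j$: $[s,t] \in \mathsf{MUS}(T[i..j])$ and $[s,t] \notin \mathsf{MUS}(T[i..j+1])$ if and only if $T[s..t] = \mathit{sqs}_{i,j+1}$ and $\#\mathit{occ}_{T[i..j+1]}(\mathit{sqs}_{i,j+1}) = 2$.
   Context: For a string $W$, $W[a..b]$ is the substring from position $a$ to position $b$ (empty if $a>b$). For strings $w,W$, $\#\mathit{occ}_W(w)$ is the number of positions at which $w$ occurs in $W$, with $\#\mathit{occ}_W(\varepsilon)=|W|+1$. A substring $w$ of $W$ is unique in $W$ if $\#\mathit{occ}_W(w)=1$, repeating if $\#\mathit{occ}_W(w)\ge 2$, quasi-unique if $1\le\#\mathit{occ}_W(w)\le 2$. For $1\le i\le j\le n$, $\mathsf{MUS}(T[i..j])$ is the set of intervals $[s,t]$ with $i\le s\le t\le j$ (positions refer to $T$) such that $T[s..t]$ is unique in $T[i..j]$ and both $T[s+1..t]$ and $T[s..t-1]$ are repeating in $T[i..j]$. $\mathit{sqs}_{i,j}$ is the shortest non-empty suffix of $T[i..j]$ that is quasi-unique in $T[i..j]$. -}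

module Defs where

open import Data.Nat using (ℕ; zero; suc; _+_; _∸_; _≤_; _<_)
open import Data.List using (List; []; length; take; drop; upTo; filter)
open import Data.List.Properties using (≡-dec)
open import Data.Product using (Σ; _×_; ∃)
open import Relation.Nullary using (¬_)
open import Relation.Binary.PropositionalEquality using (_≡_)
open import Relation.Binary.Definitions using (DecidableEquality)

module Strings {A : Set} (_≟_ : DecidableEquality A) where

  -- W[a..b] with 1-based positions; empty when a > b
  sub : List A → ℕ → ℕ → List A
  sub W a b = take (suc b ∸ a) (drop (a ∸ 1) W)

  -- #occ_W(w): number of (0-based) start positions p ∈ {0,…,|W|}
  -- at which w occurs in W; gives |W|+1 for the empty word
  occ : List A → List A → ℕ
  occ W w = length (filter (λ p → ≡-dec _≟_ (take (length w) (drop p W)) w)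
                           (upTo (suc (length W))))

  Unique : List A → List A → Set
  Unique W w = occ W w ≡ 1

  Repeating : List A → List A → Set
  Repeating W w = 2 ≤ occ W w

  QuasiUnique : List A → List A → Set
  QuasiUnique W w = 1 ≤ occ W w × occ W w ≤ 2

  -- [s,t] ∈ MUS(T[i..j])  (positions refer to T, 1-based)
  InMUS : List A → ℕ → ℕ → ℕ → ℕ → Set
  InMUS T i j s t =
    (i ≤ s × s ≤ t × t ≤ j) ×
    Unique (sub T i j) (sub T s t) ×
    Repeating (sub T i j) (sub T (suc s) t) ×
    Repeating (sub T i j) (sub T s (t ∸ 1))

  suffix : List A → ℕ → List A
  suffix W k = drop (length W ∸ k) W

  IsSQS : List A → List A → Set
  IsSQS W w = Σ ℕ λ k →
    (1 ≤ k × k ≤ length W) × w ≡ suffix W k × QuasiUnique W w ×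
    (∀ k′ → 1 ≤ k′ → k′ < k → ¬ QuasiUnique W (suffix W k′))

  IsSqs : List A → ℕ → ℕ → List A → Set
  IsSqs T i j w = IsSQS (sub T i j) w

-- Write W = T[i..j] and W′ = W c = T[i..j+1]. Appending c gives a non-empty word v one new
-- occurrence if v is a suffix of W′, and none otherwise. So the tail T[s+1..t] and the init
-- T[s..t-1] of a MUS w = T[s..t] of W stay repeating in W′, and w leaves the MUS set only by
-- losing uniqueness, i.e. by being a suffix of W′, which then occurs exactly twice. Every
-- shorter suffix of W′ is a suffix of the tail, which repeats in W, so it occurs at least
-- three times in W′; hence w = sqs_{i,j+1}.
-- Conversely, if w = sqs_{i,j+1} occurs twice in W′, it is unique in W. Its tail is a shorter
-- suffix of W′, so by minimality it occurs at least three times in W′, i.e. twice in W; and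
-- its init occurs in W both inside the unique occurrence of w and at the end of W.

module Submission where

open import Defs
open import Data.Nat using (ℕ; zero; suc; _+_; _∸_; _⊓_; _≤_; _<_; _≤?_; z≤n; s≤s)
open import Data.Nat.Properties
open import Data.List
  using (List; []; _∷_; _++_; [_]; _∷ʳ_; length; take; drop; filter; upTo; lookup)
open import Data.Fin using (Fin; fromℕ<)
open import Data.Fin.Properties using (toℕ-fromℕ<)
open import Data.List.Properties
  using ( upTo-∷ʳ; filter-++; length-++; length-take; length-drop; drop-drop
        ; take-all; take-take; take-drop; take-suc; ∷-injective; ≡-dec)
open import Data.Product using (Σ-syntax; _×_; _,_; proj₁; proj₂)
open import Data.Product.Function.NonDependent.Propositional using (_×-⇔_)
open import Data.Sum using (_⊎_; inj₁; inj₂)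
open import Data.Empty using (⊥-elim)
open import Function using (_∘′_)
open import Function.Bundles using (_⇔_; mk⇔; Equivalence)
open import Function.Properties.Equivalence using () renaming (trans to ⇔-trans)
open import Function.Related.TypeIsomorphisms using (¬-cong-⇔)
open import Relation.Nullary using (¬_; Dec; yes; no)
open import Relation.Unary using (Decidable)
open import Relation.Binary.PropositionalEquality hiding ([_])
open import Relation.Binary.Definitions using (DecidableEquality)

open Equivalence using (to; from)

countBelow : {P : ℕ → Set} → Decidable P → ℕ → ℕ
countBelow P? m = length (filter P? (upTo m))

module _ {P : ℕ → Set} (P? : Decidable P) where

  countBelow-suc : ∀ m → countBelow P? (suc m) ≡ countBelow P? m + length (filter P? [ m ])
  countBelow-suc m = begin
    length (filter P? (upTo (suc m)))               ≡⟨ cong (length ∘′ filter P?) (upTo-∷ʳ m) ⟨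
    length (filter P? (upTo m ++ [ m ]))            ≡⟨ cong length (filter-++ P? (upTo m) [ m ]) ⟩
    length (filter P? (upTo m) ++ filter P? [ m ])  ≡⟨ length-++ (filter P? (upTo m)) ⟩
    countBelow P? m + length (filter P? [ m ])      ∎
    where open ≡-Reasoning

  countBelow-accept : ∀ {m} → P m → countBelow P? (suc m) ≡ suc (countBelow P? m)
  countBelow-accept {m} Pm rewrite countBelow-suc m with P? m
  ... | yes _  = +-comm (countBelow P? m) 1
  ... | no ¬Pm = ⊥-elim (¬Pm Pm)

  countBelow-reject : ∀ {m} → ¬ P m → countBelow P? (suc m) ≡ countBelow P? m
  countBelow-reject {m} ¬Pm rewrite countBelow-suc m with P? m
  ... | yes Pm = ⊥-elim (¬Pm Pm)
  ... | no _   = +-identityʳ (countBelow P? m)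

  countBelow-≤-suc : ∀ m → countBelow P? m ≤ countBelow P? (suc m)
  countBelow-≤-suc m rewrite countBelow-suc m = m≤m+n _ _

  countBelow-mono : ∀ {m m′} → m ≤ m′ → countBelow P? m ≤ countBelow P? m′
  countBelow-mono {m′ = zero} z≤n = ≤-refl
  countBelow-mono {m′ = suc m′} m≤ with m≤n⇒m<n∨m≡n m≤
  ... | inj₁ m<m′ = ≤-trans (countBelow-mono (≤-pred m<m′)) (countBelow-≤-suc m′)
  ... | inj₂ refl = ≤-refl

  witness⇒1≤countBelow : ∀ {p m} → P p → p < m → 1 ≤ countBelow P? m
  witness⇒1≤countBelow {p} {m} Pp p<m = begin
    1                     ≤⟨ s≤s z≤n ⟩
    suc (countBelow P? p) ≡⟨ countBelow-accept Pp ⟨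
    countBelow P? (suc p) ≤⟨ countBelow-mono p<m ⟩
    countBelow P? m       ∎
    where open ≤-Reasoning

  witnesses⇒2≤countBelow : ∀ {p q m} → P p → P q → p < q → q < m → 2 ≤ countBelow P? m
  witnesses⇒2≤countBelow {q = q} {m} Pp Pq p<q q<m = begin
    2                     ≤⟨ s≤s (witness⇒1≤countBelow Pp p<q) ⟩
    suc (countBelow P? q) ≡⟨ countBelow-accept Pq ⟨
    countBelow P? (suc q) ≤⟨ countBelow-mono q<m ⟩
    countBelow P? m       ∎
    where open ≤-Reasoning

  1≤countBelow⇒witness : ∀ m → 1 ≤ countBelow P? m → Σ[ p ∈ ℕ ] p < m × P p
  1≤countBelow⇒witness (suc m) 1≤c with P? m
  ... | yes Pm  = m , ≤-refl , Pm
  ... | no ¬Pm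
    with p , p<m , Pp ← 1≤countBelow⇒witness m (≤-trans 1≤c (≤-reflexive (countBelow-reject ¬Pm)))
    = p , m≤n⇒m≤1+n p<m , Pp

  2≤countBelow⇒witnesses : ∀ m → 2 ≤ countBelow P? m →
                           Σ[ p ∈ ℕ ] Σ[ q ∈ ℕ ] p < q × q < m × P p × P q
  2≤countBelow⇒witnesses (suc m) 2≤c with P? m
  ... | yes Pm
    with p , p<m , Pp ← 1≤countBelow⇒witness m (≤-pred (≤-trans 2≤c (≤-reflexive (countBelow-accept Pm))))
    = p , m , p<m , ≤-refl , Pp , Pm
  ... | no ¬Pm
    with p , q , p<q , q<m , Pp , Pq
           ← 2≤countBelow⇒witnesses m (≤-trans 2≤c (≤-reflexive (countBelow-reject ¬Pm)))
    = p , q , p<q , m≤n⇒m≤1+n q<m , Pp , Pq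

module _ {P Q : ℕ → Set} (P? : Decidable P) (Q? : Decidable Q) where

  countBelow-cong : ∀ m → (∀ {p} → p < m → P p ⇔ Q p) → countBelow P? m ≡ countBelow Q? m
  countBelow-cong zero    P⇔Q = refl
  countBelow-cong (suc m) P⇔Q with P? m
  ... | yes Pm
    rewrite countBelow-accept P? Pm | countBelow-accept Q? (to (P⇔Q ≤-refl) Pm)
    = cong suc (countBelow-cong m (P⇔Q ∘′ m≤n⇒m≤1+n))
  ... | no ¬Pm
    rewrite countBelow-reject P? ¬Pm | countBelow-reject Q? (¬Pm ∘′ from (P⇔Q ≤-refl))
    = countBelow-cong m (P⇔Q ∘′ m≤n⇒m≤1+n)

  private
    Q⇒P-off : ∀ {e p} → Q p ⇔ (P p ⊎ p ≡ e) → p ≢ e → Q p → P p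
    Q⇒P-off Q⇔P+e p≢e Qp with to Q⇔P+e Qp
    ... | inj₁ Pp  = Pp
    ... | inj₂ p≡e = ⊥-elim (p≢e p≡e)

  countBelow-insert : ∀ {e} m → (∀ p → Q p ⇔ (P p ⊎ p ≡ e)) → ¬ P e → e < m →
                      countBelow Q? m ≡ suc (countBelow P? m)
  countBelow-insert {e} (suc m) Q⇔P+e ¬Pe e<1+m with m≤n⇒m<n∨m≡n (≤-pred e<1+m)
  ... | inj₂ refl
    rewrite countBelow-accept Q? (from (Q⇔P+e e) (inj₂ refl)) | countBelow-reject P? ¬Pe
    = cong suc (sym (countBelow-cong m λ {p} p<e →
        mk⇔ (from (Q⇔P+e p) ∘′ inj₁) (Q⇒P-off (Q⇔P+e p) (<⇒≢ p<e))))
  ... | inj₁ e<m with P? m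
  ...   | yes Pm
    rewrite countBelow-accept Q? (from (Q⇔P+e m) (inj₁ Pm)) | countBelow-accept P? Pm
    = cong suc (countBelow-insert m Q⇔P+e ¬Pe e<m)
  ...   | no ¬Pm
    rewrite countBelow-reject P? ¬Pm | countBelow-reject Q? (¬Pm ∘′ Q⇒P-off (Q⇔P+e m) (≢-sym (<⇒≢ e<m)))
    = countBelow-insert m Q⇔P+e ¬Pe e<m

module _ {A : Set} where

  take-++ˡ : ∀ k (xs ys : List A) → k ≤ length xs → take k (xs ++ ys) ≡ take k xs
  take-++ˡ zero    xs       ys _         = refl
  take-++ˡ (suc k) (x ∷ xs) ys (s≤s k≤) = cong (x ∷_) (take-++ˡ k xs ys k≤)

  drop-++ˡ : ∀ p (xs ys : List A) → p ≤ length xs → drop p (xs ++ ys) ≡ drop p xs ++ ys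
  drop-++ˡ zero    xs       ys _         = refl
  drop-++ˡ (suc p) (x ∷ xs) ys (s≤s p≤) = drop-++ˡ p xs ys p≤

  length-∷ʳ : ∀ (xs : List A) x → length (xs ∷ʳ x) ≡ suc (length xs)
  length-∷ʳ xs x = trans (length-++ xs) (+-comm (length xs) 1)

  prefix⇒length≤ : ∀ (v ys : List A) → take (length v) ys ≡ v → length v ≤ length ys
  prefix⇒length≤ v ys v≡ = begin
    length v                          ≡⟨ cong length v≡ ⟨
    length (take (length v) ys)       ≡⟨ length-take (length v) ys ⟩
    length v ⊓ length ys              ≤⟨ m⊓n≤n (length v) (length ys) ⟩
    length ys                         ∎
    where open ≤-Reasoning

  prefix-drop : ∀ d (v ys : List A) → take (length v) ys ≡ v →
                take (length (drop d v)) (drop d ys) ≡ drop d v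
  prefix-drop zero    v        ys       v≡ = v≡
  prefix-drop (suc d) []       ys       v≡ = refl
  prefix-drop (suc d) (x ∷ v)  []       ()
  prefix-drop (suc d) (x ∷ v)  (y ∷ ys) v≡ = prefix-drop d v ys (proj₂ (∷-injective v≡))

  prefix-take : ∀ k (v ys : List A) → take (length v) ys ≡ v →
                take (length (take k v)) ys ≡ take k v
  prefix-take k v ys v≡ = begin
    take (length (take k v)) ys     ≡⟨ cong (λ m → take m ys) (length-take k v) ⟩
    take (k ⊓ length v) ys          ≡⟨ take-take k (length v) ys ⟨
    take k (take (length v) ys)     ≡⟨ cong (take k) v≡ ⟩
    take k v                        ∎
    where open ≡-Reasoning

module Occurrences {A : Set} (_≟_ : DecidableEquality A) where
  open Strings _≟_

  -- occ X v unfolds to countBelow (occursAt? X v) (suc (length X)).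
  OccursAt : List A → List A → ℕ → Set
  OccursAt X v p = take (length v) (drop p X) ≡ v

  occursAt? : ∀ X v → Decidable (OccursAt X v)
  occursAt? X v p = ≡-dec _≟_ (take (length v) (drop p X)) v

  EndsWith : List A → List A → Set
  EndsWith X v = v ≡ suffix X (length v)

  endsWith? : ∀ X v → Dec (EndsWith X v)
  endsWith? X v = ≡-dec _≟_ v (suffix X (length v))

  occursAt⇒bound : ∀ {v} p X → 1 ≤ length v → OccursAt X v p → p + length v ≤ length X
  occursAt⇒bound {v} zero X _ v≡ = prefix⇒length≤ v X v≡
  occursAt⇒bound {_ ∷ _} (suc p) []      _ ()
  occursAt⇒bound         (suc p) (x ∷ X) 1≤|v| v≡ = s≤s (occursAt⇒bound p X 1≤|v| v≡)

  occ-nonempty : ∀ X v → 1 ≤ length v → occ X v ≡ countBelow (occursAt? X v) (length X)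
  occ-nonempty X v 1≤|v| = countBelow-reject (occursAt? X v) λ at-|X| →
    m+1+n≰m (length X)
      (≤-trans (+-monoʳ-≤ (length X) 1≤|v|) (occursAt⇒bound (length X) X 1≤|v| at-|X|))

  occursAt-drop : ∀ {X v} p d → OccursAt X v p → OccursAt X (drop d v) (p + d)
  occursAt-drop {X} {v} p d at-p = begin
    take (length (drop d v)) (drop (p + d) X)       ≡⟨ cong (take _) (drop-drop p d X) ⟨
    take (length (drop d v)) (drop d (drop p X))    ≡⟨ prefix-drop d v (drop p X) at-p ⟩
    drop d v                                        ∎
    where open ≡-Reasoning

  occursAt-take : ∀ {X v} p k → OccursAt X v p → OccursAt X (take k v) p
  occursAt-take {X} {v} p k = prefix-take k v (drop p X)

  repeating-drop : ∀ {X v} d → 1 ≤ length (drop d v) → Repeating X v → Repeating X (drop d v)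
  repeating-drop {X} {v} d 1≤ rep
    with p , q , p<q , _ , at-p , at-q ← 2≤countBelow⇒witnesses (occursAt? X v) (suc (length X)) rep =
    witnesses⇒2≤countBelow (occursAt? X (drop d v))
      (occursAt-drop p d at-p) (occursAt-drop q d at-q) (+-monoˡ-< d p<q)
      (s≤s (m+n≤o⇒m≤o (q + d) (occursAt⇒bound (q + d) X 1≤ (occursAt-drop q d at-q))))

  length-suffix : ∀ X {k} → k ≤ length X → length (suffix X k) ≡ k
  length-suffix X {k} k≤ = trans (length-drop (length X ∸ k) X) (m∸[m∸n]≡n k≤)

  length-suffix≤ : ∀ X k → length (suffix X k) ≤ length X
  length-suffix≤ X k =
    ≤-trans (≤-reflexive (length-drop (length X ∸ k) X)) (m∸n≤m (length X) (length X ∸ k))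

  endsWith⇒length≤ : ∀ X {v} → EndsWith X v → length v ≤ length X
  endsWith⇒length≤ X {v} v≡ = ≤-trans (≤-reflexive (cong length v≡)) (length-suffix≤ X (length v))

  suffix-endsWith : ∀ X {k} → k ≤ length X → EndsWith X (suffix X k)
  suffix-endsWith X k≤ = cong (suffix X) (sym (length-suffix X k≤))

  suffix-occursAt : ∀ X {k} → k ≤ length X → OccursAt X (suffix X k) (length X ∸ k)
  suffix-occursAt X {k} k≤ = take-all (length (suffix X k)) (suffix X k) ≤-refl

  endsWith⇔occursAt-end : ∀ X v → EndsWith X v ⇔ OccursAt X v (length X ∸ length v)
  endsWith⇔occursAt-end X v = mk⇔
    (λ v≡ → trans (cong (take (length v)) (sym v≡)) (take-all (length v) v ≤-refl))
    (λ at-e → trans (sym at-e) (take-all (length v) (suffix X (length v))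
                                 (≤-reflexive (length-suffix X (|v|≤|X| at-e)))))
    where
    |v|≤|X| : OccursAt X v (length X ∸ length v) → length v ≤ length X
    |v|≤|X| at-e = ≤-trans (prefix⇒length≤ v _ at-e) (length-suffix≤ X (length v))

  suffix-suffix : ∀ X {k m} → k ≤ m → m ≤ length X → suffix (suffix X m) k ≡ suffix X k
  suffix-suffix X {k} {m} k≤m m≤|X| = begin
    drop (length (suffix X m) ∸ k) (suffix X m)
      ≡⟨ cong (λ l → drop (l ∸ k) (suffix X m)) (length-suffix X m≤|X|) ⟩
    drop (m ∸ k) (drop (length X ∸ m) X)
      ≡⟨ drop-drop (length X ∸ m) (m ∸ k) X ⟩
    drop (length X ∸ m + (m ∸ k)) X
      ≡⟨ cong (λ l → drop l X) offset ⟩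
    suffix X k
      ∎
    where
    open ≡-Reasoning
    offset : length X ∸ m + (m ∸ k) ≡ length X ∸ k
    offset = trans (sym (+-∸-assoc (length X ∸ m) k≤m)) (cong (_∸ k) (m∸n+n≡m m≤|X|))

  suffix-∷ : ∀ x u {k} → k ≤ length u → suffix (x ∷ u) k ≡ suffix u k
  suffix-∷ x u {k} k≤ = cong (λ l → drop l (x ∷ u)) (+-∸-assoc 1 k≤)

  suffix-length : ∀ u → suffix u (length u) ≡ u
  suffix-length u = cong (λ l → drop l u) (n∸n≡0 (length u))

  suffix-∷ʳ : ∀ W x {k} → k ≤ length W → suffix (W ∷ʳ x) (suc k) ≡ suffix W k ∷ʳ x
  suffix-∷ʳ W x {k} k≤ = begin
    drop (length (W ∷ʳ x) ∸ suc k) (W ++ [ x ])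
      ≡⟨ cong (λ l → drop (l ∸ suc k) (W ++ [ x ])) (length-∷ʳ W x) ⟩
    drop (length W ∸ k) (W ++ [ x ])
      ≡⟨ drop-++ˡ (length W ∸ k) W [ x ] (m∸n≤m (length W) k) ⟩
    suffix W k ∷ʳ x
      ∎
    where open ≡-Reasoning

  sqs⇒endsWith : ∀ {X w} → IsSQS X w → EndsWith X w
  sqs⇒endsWith {X} (k , (_ , k≤) , w≡ , _) = subst (EndsWith X) (sym w≡) (suffix-endsWith X k≤)

  endsWith-suffix : ∀ {X w k} → EndsWith X w → k ≤ length w → suffix X k ≡ suffix w k
  endsWith-suffix {X} {w} {k} ends k≤|w| = begin
    suffix X k                       ≡⟨ suffix-suffix X k≤|w| (endsWith⇒length≤ X ends) ⟨
    suffix (suffix X (length w)) k   ≡⟨ cong (λ v → suffix v k) ends ⟨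
    suffix w k                       ∎
    where open ≡-Reasoning

  -- [s,t] ∈ MUS(W) in terms of w = T[s..t] alone: drop 1 w is T[s+1..t], take (|w| ∸ 1) w is T[s..t-1].
  MinimalUnique : List A → List A → Set
  MinimalUnique W w = Unique W w × Repeating W (drop 1 w) × Repeating W (take (length w ∸ 1) w)

  module Extension (W : List A) (c : A) where

    W′ : List A
    W′ = W ∷ʳ c

    take-drop-∷ʳ : ∀ {v : List A} p → p + length v ≤ length W →
                   take (length v) (drop p W′) ≡ take (length v) (drop p W)
    take-drop-∷ʳ {v} p bound = begin
      take (length v) (drop p (W ++ [ c ]))  ≡⟨ cong (take (length v)) (drop-++ˡ p W [ c ] p≤|W|) ⟩
      take (length v) (drop p W ++ [ c ])    ≡⟨ take-++ˡ (length v) (drop p W) [ c ] |v|≤ ⟩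
      take (length v) (drop p W)             ∎
      where
      open ≡-Reasoning
      p≤|W| : p ≤ length W
      p≤|W| = m+n≤o⇒m≤o p bound
      |v|≤ : length v ≤ length (drop p W)
      |v|≤ = subst (length v ≤_) (sym (length-drop p W))
               (m+n≤o⇒m≤o∸n (length v) (subst (_≤ length W) (+-comm p (length v)) bound))

    occursAt-∷ʳ⁺ : ∀ {v : List A} p → 1 ≤ length v → OccursAt W v p → OccursAt W′ v p
    occursAt-∷ʳ⁺ {v} p 1≤|v| at-p =
      trans (take-drop-∷ʳ {v} p (occursAt⇒bound {v} p W 1≤|v| at-p)) at-p

    occursAt-∷ʳ⁻ : ∀ {v : List A} p → 1 ≤ length v → OccursAt W′ v p →
                   OccursAt W v p ⊎ p ≡ length W′ ∸ length v
    occursAt-∷ʳ⁻ {v} p 1≤|v| at-p with p + length v ≤? length W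
    ... | yes bound  = inj₁ (trans (sym (take-drop-∷ʳ {v} p bound)) at-p)
    ... | no  ¬bound = inj₂ (begin
      p                        ≡⟨ m+n∸n≡m p (length v) ⟨
      p + length v ∸ length v  ≡⟨ cong (_∸ length v) p+|v|≡|W′| ⟩
      length W′ ∸ length v     ∎)
      where
      open ≡-Reasoning
      p+|v|≡|W′| : p + length v ≡ length W′
      p+|v|≡|W′| = ≤-antisym (occursAt⇒bound {v} p W′ 1≤|v| at-p)
                             (≤-trans (≤-reflexive (length-∷ʳ W c)) (≰⇒> ¬bound))

    occ-∷ʳ : ∀ v → 1 ≤ length v → occ W′ v ≡ countBelow (occursAt? W′ v) (suc (length W))
    occ-∷ʳ v 1≤|v| =
      trans (occ-nonempty W′ v 1≤|v|) (cong (countBelow (occursAt? W′ v)) (length-∷ʳ W c))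

    occ-∷ʳ-endsWith : ∀ v → 1 ≤ length v → EndsWith W′ v → occ W′ v ≡ suc (occ W v)
    occ-∷ʳ-endsWith v 1≤|v| ends =
      trans (occ-∷ʳ v 1≤|v|)
            (countBelow-insert (occursAt? W v) (occursAt? W′ v) (suc (length W)) split ¬at-e e<1+|W|)
      where
      e : ℕ
      e = length W′ ∸ length v
      e+|v|≡1+|W| : e + length v ≡ suc (length W)
      e+|v|≡1+|W| = trans (m∸n+n≡m (endsWith⇒length≤ W′ ends)) (length-∷ʳ W c)
      ¬at-e : ¬ OccursAt W v e
      ¬at-e at-e = 1+n≰n (subst (_≤ length W) e+|v|≡1+|W| (occursAt⇒bound {v} e W 1≤|v| at-e))
      e<1+|W| : e < suc (length W)
      e<1+|W| = s≤s (subst (λ l → l ∸ length v ≤ length W) (sym (length-∷ʳ W c))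
                           (∸-monoʳ-≤ (suc (length W)) 1≤|v|))
      at-e : OccursAt W′ v e
      at-e = to (endsWith⇔occursAt-end W′ v) ends
      split : ∀ p → OccursAt W′ v p ⇔ (OccursAt W v p ⊎ p ≡ e)
      split p = mk⇔ (occursAt-∷ʳ⁻ p 1≤|v|) λ where
        (inj₁ at-p) → occursAt-∷ʳ⁺ p 1≤|v| at-p
        (inj₂ refl) → at-e

    occ-∷ʳ-¬endsWith : ∀ v → 1 ≤ length v → ¬ EndsWith W′ v → occ W′ v ≡ occ W v
    occ-∷ʳ-¬endsWith v 1≤|v| ¬ends =
      trans (occ-∷ʳ v 1≤|v|)
            (countBelow-cong (occursAt? W′ v) (occursAt? W v) (suc (length W)) λ {p} _ →
              mk⇔ (W′⇒W p) (occursAt-∷ʳ⁺ p 1≤|v|))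
      where
      W′⇒W : ∀ p → OccursAt W′ v p → OccursAt W v p
      W′⇒W p at-p with occursAt-∷ʳ⁻ p 1≤|v| at-p
      ... | inj₁ at-p′ = at-p′
      ... | inj₂ refl  = ⊥-elim (¬ends (from (endsWith⇔occursAt-end W′ v) at-p))

    occ-∷ʳ-mono : ∀ v → 1 ≤ length v → occ W v ≤ occ W′ v
    occ-∷ʳ-mono v 1≤|v| with endsWith? W′ v
    ... | yes ends = ≤-trans (n≤1+n (occ W v)) (≤-reflexive (sym (occ-∷ʳ-endsWith v 1≤|v| ends)))
    ... | no ¬ends = ≤-reflexive (sym (occ-∷ʳ-¬endsWith v 1≤|v| ¬ends))

    endsWith-∷⇒length≤ : ∀ x u → EndsWith W′ (x ∷ u) → length u ≤ length W
    endsWith-∷⇒length≤ x u ends =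
      ≤-pred (≤-trans (endsWith⇒length≤ W′ ends) (≤-reflexive (length-∷ʳ W c)))

    init-endsWith : ∀ x u → EndsWith W′ (x ∷ u) → take (length u) (x ∷ u) ≡ suffix W (length u)
    init-endsWith x u ends = begin
      take (length u) (x ∷ u)
        ≡⟨ cong (take (length u)) ends ⟩
      take (length u) (suffix W′ (suc (length u)))
        ≡⟨ cong (take (length u)) (suffix-∷ʳ W c |u|≤|W|) ⟩
      take (length u) (suffix W (length u) ++ [ c ])
        ≡⟨ take-++ˡ (length u) _ [ c ] (≤-reflexive (sym |suffix|)) ⟩
      take (length u) (suffix W (length u))
        ≡⟨ take-all (length u) _ (≤-reflexive |suffix|) ⟩
      suffix W (length u)
        ∎
      where
      open ≡-Reasoning
      |u|≤|W| : length u ≤ length W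
      |u|≤|W| = endsWith-∷⇒length≤ x u ends
      |suffix| : length (suffix W (length u)) ≡ length u
      |suffix| = length-suffix W |u|≤|W|

    minimalUnique-lost⇒endsWith : ∀ w → 2 ≤ length w → MinimalUnique W w → ¬ MinimalUnique W′ w →
                                  EndsWith W′ w
    minimalUnique-lost⇒endsWith w@(_ ∷ _ ∷ _) (s≤s (s≤s z≤n)) (unique , rep-tail , rep-init) ¬mu′
      with endsWith? W′ w
    ... | yes ends = ends
    ... | no ¬ends = ⊥-elim (¬mu′ ( trans (occ-∷ʳ-¬endsWith w (s≤s z≤n) ¬ends) unique
                                  , ≤-trans rep-tail (occ-∷ʳ-mono (drop 1 w) (s≤s z≤n))
                                  , ≤-trans rep-init (occ-∷ʳ-mono (take (length w ∸ 1) w) (s≤s z≤n))))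

    endsWith⇒shorter-suffixes-not-quasiUnique :
      ∀ x u → EndsWith W′ (x ∷ u) → Repeating W u →
      ∀ k → 1 ≤ k → k < length (x ∷ u) → ¬ QuasiUnique W′ (suffix W′ k)
    endsWith⇒shorter-suffixes-not-quasiUnique x u ends rep k 1≤k (s≤s k≤|u|) (_ , occ≤2) =
      1+n≰n (≤-trans (s≤s (repeating-drop (length u ∸ k) 1≤|v| rep))
                     (≤-trans (≤-reflexive (sym occ-v)) (subst (λ y → occ W′ y ≤ 2) suffix≡v occ≤2)))
      where
      v : List A
      v = suffix u k
      suffix≡v : suffix W′ k ≡ v
      suffix≡v = trans (endsWith-suffix ends (m≤n⇒m≤1+n k≤|u|)) (suffix-∷ x u k≤|u|)
      |v|≡k : length v ≡ k
      |v|≡k = length-suffix u k≤|u|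
      1≤|v| : 1 ≤ length v
      1≤|v| = subst (1 ≤_) (sym |v|≡k) 1≤k
      occ-v : occ W′ v ≡ suc (occ W v)
      occ-v = occ-∷ʳ-endsWith v 1≤|v| (trans (sym suffix≡v) (cong (suffix W′) (sym |v|≡k)))

    sqs⇒tail-repeating : ∀ x u → 1 ≤ length u → IsSQS W′ (x ∷ u) → Repeating W u
    sqs⇒tail-repeating x u 1≤|u| sqs@(k , (_ , k≤) , w≡ , _ , shortest) =
      ≰⇒> λ occ≤1 →
        ¬quasiUnique (subst (1 ≤_) (sym occ-u) (s≤s z≤n) , subst (_≤ 2) (sym occ-u) (s≤s occ≤1))
      where
      ends : EndsWith W′ (x ∷ u)
      ends = sqs⇒endsWith sqs
      u≡ : u ≡ suffix W′ (length u)
      u≡ = sym (begin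
        suffix W′ (length u)       ≡⟨ endsWith-suffix ends (n≤1+n (length u)) ⟩
        suffix (x ∷ u) (length u)  ≡⟨ suffix-∷ x u ≤-refl ⟩
        suffix u (length u)        ≡⟨ suffix-length u ⟩
        u                          ∎)
        where open ≡-Reasoning
      |u|<k : length u < k
      |u|<k = ≤-reflexive (trans (cong length w≡) (length-suffix W′ k≤))
      ¬quasiUnique : ¬ QuasiUnique W′ u
      ¬quasiUnique = subst (λ y → ¬ QuasiUnique W′ y) (sym u≡) (shortest (length u) 1≤|u| |u|<k)
      occ-u : occ W′ u ≡ suc (occ W u)
      occ-u = occ-∷ʳ-endsWith u 1≤|u| u≡

    unique-endsWith⇒init-repeating : ∀ x u → EndsWith W′ (x ∷ u) → Unique W (x ∷ u) →
                                     Repeating W (take (length u) (x ∷ u))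
    unique-endsWith⇒init-repeating x u ends unique
      with p , _ , at-p ← 1≤countBelow⇒witness (occursAt? W (x ∷ u)) (suc (length W))
                                                (≤-reflexive (sym unique)) =
      witnesses⇒2≤countBelow (occursAt? W (take (length u) (x ∷ u)))
        (occursAt-take p (length u) at-p) at-end p<end (s≤s (m∸n≤m (length W) (length u)))
      where
      at-end : OccursAt W (take (length u) (x ∷ u)) (length W ∸ length u)
      at-end = subst (λ v → OccursAt W v (length W ∸ length u)) (sym (init-endsWith x u ends))
                 (suffix-occursAt W (endsWith-∷⇒length≤ x u ends))
      p<end : p < length W ∸ length u
      p<end = m+n≤o⇒m≤o∸n (suc p)
                (subst (_≤ length W) (+-suc p (length u)) (occursAt⇒bound p W (s≤s z≤n) at-p))

    minimalUnique-lost⇔sqs : ∀ w → 2 ≤ length w →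
      (MinimalUnique W w × ¬ MinimalUnique W′ w) ⇔ (IsSQS W′ w × occ W′ w ≡ 2)
    minimalUnique-lost⇔sqs w@(x ∷ u@(_ ∷ _)) (s≤s (s≤s z≤n)) = mk⇔ lost⇒sqs sqs⇒lost
      where
      lost⇒sqs : MinimalUnique W w × ¬ MinimalUnique W′ w → IsSQS W′ w × occ W′ w ≡ 2
      lost⇒sqs (mu@(unique , rep-tail , _) , ¬mu′) =
        (length w , (s≤s z≤n , endsWith⇒length≤ W′ ends) , ends ,
         (subst (1 ≤_) (sym occ≡2) (s≤s z≤n) , ≤-reflexive occ≡2) ,
         endsWith⇒shorter-suffixes-not-quasiUnique x u ends rep-tail) , occ≡2
        where
        ends : EndsWith W′ w
        ends = minimalUnique-lost⇒endsWith w (s≤s (s≤s z≤n)) mu ¬mu′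
        occ≡2 : occ W′ w ≡ 2
        occ≡2 = trans (occ-∷ʳ-endsWith w (s≤s z≤n) ends) (cong suc unique)
      sqs⇒lost : IsSQS W′ w × occ W′ w ≡ 2 → MinimalUnique W w × ¬ MinimalUnique W′ w
      sqs⇒lost (sqs , occ≡2) =
        ( unique
        , sqs⇒tail-repeating x u (s≤s z≤n) sqs
        , unique-endsWith⇒init-repeating x u ends unique ) ,
        λ (unique′ , _) → <⇒≢ (s≤s (s≤s z≤n)) (trans (sym unique′) occ≡2)
        where
        ends : EndsWith W′ w
        ends = sqs⇒endsWith sqs
        unique : Unique W w
        unique = suc-injective (trans (sym (occ-∷ʳ-endsWith w (s≤s z≤n) ends)) occ≡2)

  -- sub is 1-based: the lemmas below speak of positions suc s, so s letters of T precede them.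
  length-sub : ∀ T {s t} → s ≤ t → t < length T → length (sub T (suc s) (suc t)) ≡ suc (t ∸ s)
  length-sub T {s} {t} s≤t t<|T| = begin
    length (take (suc t ∸ s) (drop s T))   ≡⟨ length-take (suc t ∸ s) (drop s T) ⟩
    (suc t ∸ s) ⊓ length (drop s T)        ≡⟨ m≤n⇒m⊓n≡m fits ⟩
    suc t ∸ s                              ≡⟨ +-∸-assoc 1 s≤t ⟩
    suc (t ∸ s)                            ∎
    where
    open ≡-Reasoning
    fits : suc t ∸ s ≤ length (drop s T)
    fits = subst (suc t ∸ s ≤_) (sym (length-drop s T)) (∸-monoˡ-≤ s t<|T|)

  sub-tail : ∀ T {s t} → s < t → sub T (suc (suc s)) t ≡ drop 1 (sub T (suc s) t)
  sub-tail T {s} {t} s<t = begin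
    take (t ∸ suc s) (drop (suc s) T)
      ≡⟨ cong (λ l → take (t ∸ suc s) (drop l T)) (+-comm 1 s) ⟩
    take (t ∸ suc s) (drop (s + 1) T)
      ≡⟨ cong (take (t ∸ suc s)) (drop-drop s 1 T) ⟨
    take (t ∸ suc s) (drop 1 (drop s T))
      ≡⟨ take-drop (t ∸ suc s) 1 (drop s T) ⟩
    drop 1 (take (suc (t ∸ suc s)) (drop s T))
      ≡⟨ cong (λ l → drop 1 (take l (drop s T))) (+-∸-assoc 1 s<t) ⟨
    drop 1 (take (t ∸ s) (drop s T))
      ∎
    where open ≡-Reasoning

  sub-init : ∀ T {s t} → s ≤ t → t < length T →
             sub T (suc s) t ≡ take (length (sub T (suc s) (suc t)) ∸ 1) (sub T (suc s) (suc t))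
  sub-init T {s} {t} s≤t t<|T| = sym (begin
    take (length w ∸ 1) w
      ≡⟨ cong (λ l → take (l ∸ 1) w) (length-sub T s≤t t<|T|) ⟩
    take (t ∸ s) (take (suc t ∸ s) (drop s T))
      ≡⟨ cong (λ l → take (t ∸ s) (take l (drop s T))) (+-∸-assoc 1 s≤t) ⟩
    take (t ∸ s) (take (suc (t ∸ s)) (drop s T))
      ≡⟨ take-take (t ∸ s) (suc (t ∸ s)) (drop s T) ⟩
    take ((t ∸ s) ⊓ suc (t ∸ s)) (drop s T)
      ≡⟨ cong (λ l → take l (drop s T)) (m≤n⇒m⊓n≡m (n≤1+n (t ∸ s))) ⟩
    take (t ∸ s) (drop s T)
      ∎)
    where
    open ≡-Reasoning
    w : List A
    w = sub T (suc s) (suc t)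

  sub-∷ʳ : ∀ T {i j} → i ≤ j → j < length T →
           Σ[ x ∈ A ] sub T (suc i) (suc j) ≡ sub T (suc i) j ∷ʳ x
  sub-∷ʳ T {i} {j} i≤j j<|T| = lookup Y k , (begin
    take (suc j ∸ i) Y
      ≡⟨ cong (λ l → take l Y) (+-∸-assoc 1 i≤j) ⟩
    take (suc (j ∸ i)) Y
      ≡⟨ subst (λ m → take (suc m) Y ≡ take m Y ∷ʳ lookup Y k) (toℕ-fromℕ< j∸i<|Y|) (take-suc Y k) ⟩
    take (j ∸ i) Y ∷ʳ lookup Y k
      ∎)
    where
    open ≡-Reasoning
    Y : List A
    Y = drop i T
    j∸i<|Y| : j ∸ i < length Y
    j∸i<|Y| = subst (j ∸ i <_) (sym (length-drop i T)) (∸-monoˡ-< j<|T| i≤j)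
    k : Fin (length Y)
    k = fromℕ< j∸i<|Y|

  InMUS⇔MinimalUnique : ∀ T {i j s t} → i ≤ suc s → s < t → suc t ≤ j → t < length T →
                        InMUS T i j (suc s) (suc t) ⇔ MinimalUnique (sub T i j) (sub T (suc s) (suc t))
  InMUS⇔MinimalUnique T {i} {j} {s} {t} i≤ s<t t<j t<|T| = mk⇔
    (λ (_ , unique , rep-tail , rep-init) →
      unique , subst (Repeating W) tail≡ rep-tail , subst (Repeating W) init≡ rep-init)
    (λ (unique , rep-tail , rep-init) →
      (i≤ , s≤s (<⇒≤ s<t) , t<j) , unique ,
      subst (Repeating W) (sym tail≡) rep-tail , subst (Repeating W) (sym init≡) rep-init)
    where
    W : List A
    W = sub T i j
    tail≡ : sub T (suc (suc s)) (suc t) ≡ drop 1 (sub T (suc s) (suc t))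
    tail≡ = sub-tail T (s≤s (<⇒≤ s<t))
    init≡ : sub T (suc s) t ≡ take (length (sub T (suc s) (suc t)) ∸ 1) (sub T (suc s) (suc t))
    init≡ = sub-init T (<⇒≤ s<t) t<|T|

lemma3 : {A : Set} (_≟_ : DecidableEquality A) (T : List A) (n i j s t : ℕ) →
    length T ≡ n → 1 ≤ i → i ≤ j → j < n → i ≤ s → s < t → t ≤ j →
    ((Strings.InMUS _≟_ T i j s t × ¬ Strings.InMUS _≟_ T i (suc j) s t)
      ⇔ (Strings.IsSqs _≟_ T i (suc j) (Strings.sub _≟_ T s t)
         × Strings.occ _≟_ (Strings.sub _≟_ T i (suc j)) (Strings.sub _≟_ T s t) ≡ 2))
lemma3 {A} _≟_ T _ (suc i) j (suc s) (suc t) refl (s≤s z≤n) i<j j<|T| i≤s (s≤s s<t) t<j =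
  ⇔-trans (InMUS⇔MinimalUnique T i≤s s<t t<j t<|T|
             ×-⇔ ¬-cong-⇔ (InMUS⇔MinimalUnique T i≤s s<t (m≤n⇒m≤1+n t<j) t<|T|))
          (subst (λ W′ → (MinimalUnique W w × ¬ MinimalUnique W′ w) ⇔ (IsSQS W′ w × occ W′ w ≡ 2))
                 (sym (proj₂ extension))
                 (Extension.minimalUnique-lost⇔sqs W (proj₁ extension) w 2≤|w|))
  where
  open Strings _≟_
  open Occurrences _≟_
  W w : List A
  W = sub T (suc i) j
  w = sub T (suc s) (suc t)
  t<|T| : t < length T
  t<|T| = <-trans t<j j<|T|
  extension : Σ[ x ∈ A ] sub T (suc i) (suc j) ≡ W ∷ʳ x
  extension = sub-∷ʳ T (<⇒≤ i<j) j<|T|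
  2≤|w| : 2 ≤ length w
  2≤|w| = subst (2 ≤_) (sym (length-sub T (<⇒≤ s<t) t<|T|)) (s≤s (m<n⇒0<n∸m s<t))
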